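{- Let $n\ge0$ and $0\le i<3^n$. If $C_n(i)$ is a strict local maximum of $C_n$, then $(C_{n+1}(3i),C_{n+1}(3i+1),C_{n+1}(3i+2))=(C_n(i),3C_n(i),C_n(i))$.
   Context: The unit weight-$3$ Stern–Brocot sequences $SB_n$ ($n\ge0$): $SB_0=(\frac{0}{1},\frac{1}{1})$, and $SB_{n+1}$ is obtained from $SB_n$ by keeping all its terms in order and inserting, between each pair of consecutive terms $\frac{p}{q},\frac{r}{s}$ (in lowest terms, positive denominators), the two fractions $\frac{2p+r}{2q+s}$ and $\frac{p+2r}{q+2s}$, each reduced to lowest terms, in this order. $SB_n$ has $3^n+1$ terms, indexed from $0$. For $0\le i<3^n$, $C_n(i)=qr-ps$ where $\frac{p}{q}$ and $\frac{r}{s}$ are the $i$-th and $(i+1)$-th terms of $SB_n$ in lowest terms with positive denominators. $C_n(i)$ is a strict local maximum if $C_n(i)>C_n(j)$ for each $j\in\{i-1,i+1\}$ with $0\le j<3^n$. -}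

module Defs where

open import Data.Nat using (ℕ; zero; suc; _+_; _*_; _^_; _<_)
open import Data.Nat.GCD using (gcd)
open import Data.Nat.DivMod using (_/_)
open import Data.Integer as ℤ using (ℤ; +_)
open import Data.List using (List; []; _∷_)
open import Data.Product using (_×_; _,_)
open import Relation.Binary.PropositionalEquality using (_≡_)

-- A fraction p/q represented by the pair (p , q) of naturals
-- (all terms of SB_n lie in [0,1], so numerators are nonnegative
-- and denominators positive).
Frac : Set
Frac = ℕ × ℕ

-- reduce to lowest terms (divide by the gcd; gcd = 0 only for 0/0,
-- which never occurs)
reduce : ℕ → ℕ → Frac
reduce p q with gcd p q
... | zero  = p , q
... | suc g = p / suc g , q / suc g

med₁ : Frac → Frac → Frac
med₁ (p , q) (r , s) = reduce (2 * p + r) (2 * q + s)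

med₂ : Frac → Frac → Frac
med₂ (p , q) (r , s) = reduce (p + 2 * r) (q + 2 * s)

step : List Frac → List Frac
step []           = []
step (x ∷ [])     = x ∷ []
step (x ∷ y ∷ xs) = x ∷ med₁ x y ∷ med₂ x y ∷ step (y ∷ xs)

SB : ℕ → List Frac
SB zero    = (0 , 1) ∷ (1 , 1) ∷ []
SB (suc n) = step (SB n)

-- i-th element of a list (indexed from 0); default 0/1 out of range
-- (only used for in-range indices)
nth : List Frac → ℕ → Frac
nth []       _       = 0 , 1
nth (x ∷ xs) zero    = x
nth (x ∷ xs) (suc i) = nth xs i

det : Frac → Frac → ℤ
det (p , q) (r , s) = (+ (q * r)) ℤ.- (+ (p * s))

C : ℕ → ℕ → ℤ
C n i = det (nth (SB n) i) (nth (SB n) (suc i))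

StrictLocalMax : ℕ → ℕ → Set
StrictLocalMax n i =
  ((j : ℕ) → suc j ≡ i → C n j ℤ.< C n i) ×
  (suc i < 3 ^ n → C n (suc i) ℤ.< C n i)

-- View terms of SB_n as integer vectors.  Consecutive terms x, y are linked:
-- det(x, w) = 1 for some w, and either y = -x + 3^k w (opposite) or
-- y = x + 3^(k+1) w (aligned); hence det(x, y) = 3^k and x is in lowest terms.
-- For an opposite pair, 2x + y = x + 3^k w and x + 2y = -x + 2·3^k w need no
-- reduction, and the three new gaps are linked with determinants 3^k,
-- 3^(k+1), 3^k, the middle one opposite.  For an aligned pair, 2x + y and
-- x + 2y are 3(x + 3^k w) and 3(x + 2·3^k w), and all three new gaps have
-- determinant 3^k.  So a strict local maximum of C_(n+1) is the middle gap
-- below an opposite pair; it is opposite itself, and its children have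
-- determinants C, 3C, C.
module Submission where

open import Defs

module Linking where
  open import Data.Nat as ℕ using (ℕ; suc)
  open import Data.Nat.GCD using (gcd; gcd[m,n]∣m; gcd[m,n]∣n; c*gcd[m,n]≡gcd[cm,cn])
  open import Data.Nat.Divisibility using (divides; ∣1⇒≡1)
  open import Data.Nat.DivMod using (n/1≡n; m*n/n≡m; m*[n/m]≡n)
  open import Data.Nat.Properties using () renaming (*-comm to ℕ-*-comm)
  open import Data.Integer using (ℤ; +_; 1ℤ; -1ℤ; ∣_∣; _+_; _*_; _-_)
  open import Data.Integer.Properties using (pos-+; pos-*; abs-*; *-comm; *-identityʳ; *-cancelˡ-≡)
  open import Data.Integer.Divisibility.Signed using (_∣_; ∣ᵤ⇒∣; ∣⇒∣ᵤ; ∣m∣n⇒∣m-n; ∣m⇒∣m*n)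
  open import Data.Integer.Tactic.RingSolver using (solve-∀)
  open import Data.Product using (_×_; _,_; proj₁; proj₂)
  open import Relation.Binary.PropositionalEquality
  open ≡-Reasoning

  ℤ² : Set
  ℤ² = ℤ × ℤ

  ⟦_⟧ : Frac → ℤ²
  ⟦ p , q ⟧ = + p , + q

  infixl 6 _⊕_
  infixr 7 _·_

  _⊕_ : ℤ² → ℤ² → ℤ²
  (a , b) ⊕ (c , d) = a + c , b + d

  _·_ : ℤ → ℤ² → ℤ²
  k · (a , b) = k * a , k * b

  componentwise : ∀ {f g : ℤ → ℤ → ℤ} → (∀ a c → f a c ≡ g a c) → ∀ u w →
    (f (proj₁ u) (proj₁ w) , f (proj₂ u) (proj₂ w)) ≡ (g (proj₁ u) (proj₁ w) , g (proj₂ u) (proj₂ w))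
  componentwise law (a₁ , a₂) (c₁ , c₂) = cong₂ _,_ (law a₁ c₁) (law a₂ c₂)

  D : ℤ² → ℤ² → ℤ
  D (p , q) (r , s) = q * r - p * s

  det≡D : ∀ x y → det x y ≡ D ⟦ x ⟧ ⟦ y ⟧
  det≡D (p , q) (r , s) = cong₂ _-_ (pos-* q r) (pos-* p s)

  D-shiftʳ : ∀ σ c u w → D u (σ · u ⊕ c · w) ≡ c * D u w
  D-shiftʳ σ c (a , b) (e , f) = law σ c a b e f
    where
    law : ∀ σ c a b e f → b * (σ * a + c * e) - a * (σ * b + c * f) ≡ c * (b * e - a * f)
    law = solve-∀

  D-shiftˡ : ∀ σ c u w → D (σ · u ⊕ c · w) w ≡ σ * D u w
  D-shiftˡ σ c (a , b) (e , f) = law σ c a b e f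
    where
    law : ∀ σ c a b e f → (σ * b + c * f) * e - (σ * a + c * e) * f ≡ σ * (b * e - a * f)
    law = solve-∀

  D-scaleʳ : ∀ k u w → D u (k · w) ≡ k * D u w
  D-scaleʳ k (a , b) (e , f) = law k a b e f
    where
    law : ∀ k a b e f → b * (k * e) - a * (k * f) ≡ k * (b * e - a * f)
    law = solve-∀

  Reduced : Frac → Set
  Reduced (p , q) = gcd p q ≡ 1

  unimodular⇒reduced : ∀ x w → D ⟦ x ⟧ w ≡ 1ℤ → Reduced x
  unimodular⇒reduced (p , q) (a , b) D≡1 = ∣1⇒≡1 (∣⇒∣ᵤ (subst (+ gcd p q ∣_) D≡1 g∣D))
    where
    g∣D : + gcd p q ∣ + q * a - + p * b
    g∣D = ∣m∣n⇒∣m-n (∣m⇒∣m*n a (∣ᵤ⇒∣ {i = + q} (gcd[m,n]∣n p q))) (∣m⇒∣m*n b (∣ᵤ⇒∣ {i = + p} (gcd[m,n]∣m p q)))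

  reduce′ : Frac → Frac
  reduce′ (p , q) = reduce p q

  triple third : Frac → Frac
  triple (p , q) = 3 ℕ.* p , 3 ℕ.* q
  third (p , q) = p ℕ./ 3 , q ℕ./ 3

  reduce-by-gcd : ∀ p q g → gcd p q ≡ suc g → reduce p q ≡ (p ℕ./ suc g , q ℕ./ suc g)
  reduce-by-gcd p q g eq rewrite eq = refl

  reduce-reduced : ∀ x → Reduced x → reduce′ x ≡ x
  reduce-reduced (p , q) gcd≡1 =
    trans (reduce-by-gcd p q 0 gcd≡1) (cong₂ _,_ (n/1≡n p) (n/1≡n q))

  reduce-triple : ∀ x → Reduced x → reduce′ (triple x) ≡ x
  reduce-triple (p , q) gcd≡1 =
    trans (reduce-by-gcd (3 ℕ.* p) (3 ℕ.* q) 2 gcd≡3) (cong₂ _,_ (3*n/3≡n p) (3*n/3≡n q))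
    where
    gcd≡3 : gcd (3 ℕ.* p) (3 ℕ.* q) ≡ 3
    gcd≡3 = trans (sym (c*gcd[m,n]≡gcd[cm,cn] 3 p q)) (cong (3 ℕ.*_) gcd≡1)
    3*n/3≡n : ∀ n → 3 ℕ.* n ℕ./ 3 ≡ n
    3*n/3≡n n = trans (cong (ℕ._/ 3) (ℕ-*-comm 3 n)) (m*n/n≡m n 3)

  module _ {n : ℕ} {v : ℤ} (n≡3v : + n ≡ + 3 * v) where
    3*[n/3]≡n : 3 ℕ.* (n ℕ./ 3) ≡ n
    3*[n/3]≡n = m*[n/m]≡n (divides ∣ v ∣ (trans (cong ∣_∣ (trans n≡3v (*-comm (+ 3) v))) (abs-* v (+ 3))))

    +[n/3]≡v : + (n ℕ./ 3) ≡ v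
    +[n/3]≡v = *-cancelˡ-≡ (+ 3) _ _ (trans (sym (pos-* 3 (n ℕ./ 3))) (trans (cong +_ 3*[n/3]≡n) n≡3v))

  triple-third : ∀ z v → ⟦ z ⟧ ≡ + 3 · v → triple (third z) ≡ z
  triple-third (p , q) (a , b) eq = cong₂ _,_ (3*[n/3]≡n (cong proj₁ eq)) (3*[n/3]≡n (cong proj₂ eq))

  ⟦third⟧ : ∀ z v → ⟦ z ⟧ ≡ + 3 · v → ⟦ third z ⟧ ≡ v
  ⟦third⟧ (p , q) (a , b) eq = cong₂ _,_ (+[n/3]≡v (cong proj₁ eq)) (+[n/3]≡v (cong proj₂ eq))

  mediant₁ mediant₂ : Frac → Frac → Frac
  mediant₁ (p , q) (r , s) = 2 ℕ.* p ℕ.+ r , 2 ℕ.* q ℕ.+ s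
  mediant₂ (p , q) (r , s) = p ℕ.+ 2 ℕ.* r , q ℕ.+ 2 ℕ.* s

  ⟦mediant₁⟧ : ∀ x y → ⟦ mediant₁ x y ⟧ ≡ + 2 · ⟦ x ⟧ ⊕ ⟦ y ⟧
  ⟦mediant₁⟧ (p , q) (r , s) = cong₂ _,_ (pos-2m+n p r) (pos-2m+n q s)
    where
    pos-2m+n : ∀ m n → + (2 ℕ.* m ℕ.+ n) ≡ + 2 * + m + + n
    pos-2m+n m n = trans (pos-+ (2 ℕ.* m) n) (cong (_+ + n) (pos-* 2 m))

  ⟦mediant₂⟧ : ∀ x y → ⟦ mediant₂ x y ⟧ ≡ ⟦ x ⟧ ⊕ + 2 · ⟦ y ⟧
  ⟦mediant₂⟧ (p , q) (r , s) = cong₂ _,_ (pos-m+2n p r) (pos-m+2n q s)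
    where
    pos-m+2n : ∀ m n → + (m ℕ.+ 2 ℕ.* n) ≡ + m + + 2 * + n
    pos-m+2n m n = trans (pos-+ m (2 ℕ.* n)) (cong (λ k → + m + k) (pos-* 2 n))

  -- y ≡ σ x (mod E), witnessed by a direction unimodular with x; then det x y = E.
  record Linked (σ E : ℤ) (x y : Frac) : Set where
    constructor linked
    field
      dir        : ℤ²
      unimodular : D ⟦ x ⟧ dir ≡ 1ℤ
      shift      : ⟦ y ⟧ ≡ σ · ⟦ x ⟧ ⊕ E · dir

  Linked-det : ∀ {σ E x y} → Linked σ E x y → det x y ≡ E
  Linked-det {σ} {E} {x} {y} (linked w uni sh) = begin
    det x y                      ≡⟨ det≡D x y ⟩
    D ⟦ x ⟧ ⟦ y ⟧                ≡⟨ cong (D ⟦ x ⟧) sh ⟩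
    D ⟦ x ⟧ (σ · ⟦ x ⟧ ⊕ E · w)  ≡⟨ D-shiftʳ σ E ⟦ x ⟧ w ⟩
    E * D ⟦ x ⟧ w                ≡⟨ cong (E *_) uni ⟩
    E * 1ℤ                       ≡⟨ *-identityʳ E ⟩
    E                            ∎

  Linked-reducedˡ : ∀ {σ E x y} → Linked σ E x y → Reduced x
  Linked-reducedˡ {x = x} (linked w uni _) = unimodular⇒reduced x w uni

  Linked-unimodularʳ : ∀ {σ E x y} (l : Linked σ E x y) → D ⟦ y ⟧ (Linked.dir l) ≡ σ
  Linked-unimodularʳ {σ} {E} {x} {y} (linked w uni sh) = begin
    D ⟦ y ⟧ w                    ≡⟨ cong (λ v → D v w) sh ⟩
    D (σ · ⟦ x ⟧ ⊕ E · w) w      ≡⟨ D-shiftˡ σ E ⟦ x ⟧ w ⟩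
    σ * D ⟦ x ⟧ w                ≡⟨ cong (σ *_) uni ⟩
    σ * 1ℤ                       ≡⟨ *-identityʳ σ ⟩
    σ                            ∎

  Linked-mod-1 : ∀ {x y} → Linked 1ℤ 1ℤ x y → Linked -1ℤ 1ℤ x y
  Linked-mod-1 {x} (linked w uni sh) =
    linked (+ 2 · ⟦ x ⟧ ⊕ 1ℤ · w)
      (trans (D-shiftʳ (+ 2) 1ℤ ⟦ x ⟧ w) (cong (1ℤ *_) uni))
      (trans sh (componentwise law ⟦ x ⟧ w))
    where
    law : ∀ a c → 1ℤ * a + 1ℤ * c ≡ -1ℤ * a + 1ℤ * (+ 2 * a + 1ℤ * c)
    law = solve-∀

  record Refined (R₀ R₁ R₂ : Frac → Frac → Set) (x y : Frac) : Set where
    constructor refinement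
    field
      gap₀ : R₀ x (med₁ x y)
      gap₁ : R₁ (med₁ x y) (med₂ x y)
      gap₂ : R₂ (med₂ x y) y

  refined : ∀ {R₀ R₁ R₂ : Frac → Frac → Set} {x y m₁ m₂} → med₁ x y ≡ m₁ → med₂ x y ≡ m₂ →
    R₀ x m₁ → R₁ m₁ m₂ → R₂ m₂ y → Refined R₀ R₁ R₂ x y
  refined refl refl = refinement

  Refined-map : ∀ {R₀ R₁ R₂ S₀ S₁ S₂ : Frac → Frac → Set} {x y} →
    (∀ {a b} → R₀ a b → S₀ a b) → (∀ {a b} → R₁ a b → S₁ a b) → (∀ {a b} → R₂ a b → S₂ a b) →
    Refined R₀ R₁ R₂ x y → Refined S₀ S₁ S₂ x y
  Refined-map f₀ f₁ f₂ (refinement r₀ r₁ r₂) = refinement (f₀ r₀) (f₁ r₁) (f₂ r₂)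

  refine-opposite : ∀ {E x y} → Linked -1ℤ E x y →
    Refined (Linked 1ℤ E) (Linked -1ℤ (+ 3 * E)) (Linked 1ℤ E) x y
  refine-opposite {E} {x@(_ , _)} {y@(_ , _)} (linked w uni sh) =
    refined (reduce-reduced m₁ (Linked-reducedˡ l₂)) (reduce-reduced m₂ (Linked-reducedˡ l₃)) l₁ l₂ l₃
    where
    u = ⟦ x ⟧
    m₁ = mediant₁ x y
    m₂ = mediant₂ x y
    M₁ : ⟦ m₁ ⟧ ≡ + 2 · u ⊕ (-1ℤ · u ⊕ E · w)
    M₁ = trans (⟦mediant₁⟧ x y) (cong (+ 2 · u ⊕_) sh)
    M₂ : ⟦ m₂ ⟧ ≡ u ⊕ + 2 · (-1ℤ · u ⊕ E · w)
    M₂ = trans (⟦mediant₂⟧ x y) (cong (λ v → u ⊕ + 2 · v) sh)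
    law₁ : ∀ E a c → + 2 * a + (-1ℤ * a + E * c) ≡ 1ℤ * a + E * c
    law₁ = solve-∀
    law₂ : ∀ E a c → a + + 2 * (-1ℤ * a + E * c) ≡ -1ℤ * (+ 2 * a + (-1ℤ * a + E * c)) + (+ 3 * E) * c
    law₂ = solve-∀
    law₃ : ∀ E a c → -1ℤ * a + E * c ≡ 1ℤ * (a + + 2 * (-1ℤ * a + E * c)) + E * (-1ℤ * c)
    law₃ = solve-∀
    l₁ : Linked 1ℤ E x m₁
    l₁ = linked w uni (trans M₁ (componentwise (law₁ E) u w))
    l₂ : Linked -1ℤ (+ 3 * E) m₁ m₂
    l₂ = linked w (Linked-unimodularʳ l₁)
      (trans M₂ (trans (componentwise (law₂ E) u w) (cong (λ v → -1ℤ · v ⊕ (+ 3 * E) · w) (sym M₁))))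
    l₃ : Linked 1ℤ E m₂ y
    l₃ = linked (-1ℤ · w) (trans (D-scaleʳ -1ℤ ⟦ m₂ ⟧ w) (cong (-1ℤ *_) (Linked-unimodularʳ l₂)))
      (trans sh (trans (componentwise (law₃ E) u w) (cong (λ v → 1ℤ · v ⊕ E · (-1ℤ · w)) (sym M₂))))

  refine-aligned : ∀ {F x y} → Linked 1ℤ (+ 3 * F) x y →
    Refined (Linked 1ℤ F) (Linked 1ℤ F) (Linked 1ℤ F) x y
  refine-aligned {F} {x@(_ , _)} {y@(_ , _)} (linked w uni sh) =
    refined (reduced-third P₁ (Linked-reducedˡ l₂)) (reduced-third P₂ (Linked-reducedˡ l₃)) l₁ l₂ l₃
    where
    u = ⟦ x ⟧
    reduced-third : ∀ {z v} → ⟦ z ⟧ ≡ + 3 · v → Reduced (third z) → reduce′ z ≡ third z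
    reduced-third {z} {v} eq red = trans (cong reduce′ (sym (triple-third z v eq))) (reduce-triple (third z) red)
    law₁ : ∀ F a c → + 2 * a + (1ℤ * a + (+ 3 * F) * c) ≡ + 3 * (1ℤ * a + F * c)
    law₁ = solve-∀
    law₂ : ∀ F a c → a + + 2 * (1ℤ * a + (+ 3 * F) * c) ≡ + 3 * (1ℤ * (1ℤ * a + F * c) + F * c)
    law₂ = solve-∀
    law₃ : ∀ F a c → 1ℤ * a + (+ 3 * F) * c ≡ 1ℤ * (1ℤ * (1ℤ * a + F * c) + F * c) + F * c
    law₃ = solve-∀
    P₁ : ⟦ mediant₁ x y ⟧ ≡ + 3 · (1ℤ · u ⊕ F · w)
    P₁ = trans (⟦mediant₁⟧ x y) (trans (cong (+ 2 · u ⊕_) sh) (componentwise (law₁ F) u w))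
    m₁ = third (mediant₁ x y)
    M₁ : ⟦ m₁ ⟧ ≡ 1ℤ · u ⊕ F · w
    M₁ = ⟦third⟧ (mediant₁ x y) _ P₁
    P₂ : ⟦ mediant₂ x y ⟧ ≡ + 3 · (1ℤ · ⟦ m₁ ⟧ ⊕ F · w)
    P₂ = trans (⟦mediant₂⟧ x y) (trans (cong (λ v → u ⊕ + 2 · v) sh)
      (trans (componentwise (law₂ F) u w) (cong (λ v → + 3 · (1ℤ · v ⊕ F · w)) (sym M₁))))
    m₂ = third (mediant₂ x y)
    M₂ : ⟦ m₂ ⟧ ≡ 1ℤ · ⟦ m₁ ⟧ ⊕ F · w
    M₂ = ⟦third⟧ (mediant₂ x y) _ P₂
    Y : ⟦ y ⟧ ≡ 1ℤ · ⟦ m₂ ⟧ ⊕ F · w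
    Y = trans sh (trans (componentwise (law₃ F) u w)
      (cong (λ v → 1ℤ · v ⊕ F · w) (sym (trans M₂ (cong (λ v → 1ℤ · v ⊕ F · w) M₁)))))
    l₁ : Linked 1ℤ F x m₁
    l₁ = linked w uni M₁
    l₂ : Linked 1ℤ F m₁ m₂
    l₂ = linked w (Linked-unimodularʳ l₁) M₂
    l₃ : Linked 1ℤ F m₂ y
    l₃ = linked w (Linked-unimodularʳ l₂) Y

open Linking using (Linked; linked; Linked-det; Linked-mod-1; Refined; refinement; Refined-map; refine-opposite; refine-aligned)

open import Data.Nat using (ℕ; zero; suc; _+_; _*_; _^_; _<_; s≤s; z≤n)
open import Data.Nat.Properties
  using (*-comm; +-comm; suc-injective; m≤n+m; +-monoˡ-<; *-monoˡ-≤; *-cancelʳ-<; module ≤-Reasoning)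
open import Data.Integer as ℤ using (ℤ; +_; +<+; 1ℤ; -1ℤ) renaming (_*_ to _*ℤ_; _^_ to _^ℤ_)
open import Data.Integer.Properties using (<-irrefl; <-asym; *-monoˡ-<-pos)
open import Data.List using (List; []; _∷_; length)
open import Data.Product using (_×_; _,_; ∃-syntax)
open import Data.Empty using (⊥-elim)
open import Relation.Nullary using (¬_)
open import Relation.Binary.PropositionalEquality

data Adjacent (x y : Frac) : Set where
  opposite : ∀ k → Linked -1ℤ ((+ 3) ^ℤ k) x y → Adjacent x y
  aligned  : ∀ k → Linked 1ℤ ((+ 3) ^ℤ suc k) x y → Adjacent x y

Linked⁺⇒Adjacent : ∀ {x y} k → Linked 1ℤ ((+ 3) ^ℤ k) x y → Adjacent x y
Linked⁺⇒Adjacent zero    l = opposite 0 (Linked-mod-1 l)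
Linked⁺⇒Adjacent (suc k) l = aligned k l

refine-adjacent : ∀ {x y} → Adjacent x y → Refined Adjacent Adjacent Adjacent x y
refine-adjacent (opposite k l) =
  Refined-map (Linked⁺⇒Adjacent k) (opposite (suc k)) (Linked⁺⇒Adjacent k) (refine-opposite l)
refine-adjacent (aligned k l) =
  Refined-map (Linked⁺⇒Adjacent k) (Linked⁺⇒Adjacent k) (Linked⁺⇒Adjacent k) (refine-aligned l)

AtPair : (Frac → Frac → Set) → ℕ → ℕ → Set
AtPair R n i = R (nth (SB n) i) (nth (SB n) (suc i))

Children : (R₀ R₁ R₂ : Frac → Frac → Set) → ℕ → ℕ → Set
Children R₀ R₁ R₂ n i = AtPair R₀ (suc n) (i * 3) × AtPair R₁ (suc n) (1 + i * 3) × AtPair R₂ (suc n) (2 + i * 3)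

SB₀-linked : AtPair (Linked -1ℤ 1ℤ) 0 0
SB₀-linked = linked (+ 1 , + 2) refl refl

head-step : ∀ x xs → nth (step (x ∷ xs)) 0 ≡ x
head-step x []      = refl
head-step x (_ ∷ _) = refl

length-step : ∀ x xs → length (step (x ∷ xs)) ≡ suc (length xs * 3)
length-step x []       = refl
length-step x (y ∷ ys) = cong (λ m → 3 + m) (length-step y ys)

length-SB : ∀ n → length (SB n) ≡ suc (3 ^ n)
length-SB zero = refl
length-SB (suc n) with SB n | length-SB n
... | x ∷ xs | eq = trans (length-step x xs) (cong suc (trans (cong (_* 3) (suc-injective eq)) (*-comm (3 ^ n) 3)))

nth-step : ∀ L i → suc i < length L →
  nth (step L) (i * 3) ≡ nth L i ×
  nth (step L) (1 + i * 3) ≡ med₁ (nth L i) (nth L (suc i)) ×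
  nth (step L) (2 + i * 3) ≡ med₂ (nth L i) (nth L (suc i)) ×
  nth (step L) (3 + i * 3) ≡ nth L (suc i)
nth-step (x ∷ y ∷ xs) zero    _       = refl , refl , refl , head-step y xs
nth-step (x ∷ y ∷ xs) (suc i) (s≤s h) = nth-step (y ∷ xs) i h
nth-step (x ∷ [])     _       (s≤s ())

children : ∀ {R₀ R₁ R₂} n i → i < 3 ^ n → AtPair (Refined R₀ R₁ R₂) n i → Children R₀ R₁ R₂ n i
children {R₀} {R₁} {R₂} n i i< (refinement r₀ r₁ r₂)
  with nth-step (SB n) i (subst (suc i <_) (sym (length-SB n)) (s≤s i<))
... | e₀ , e₁ , e₂ , e₃ = subst₂ R₀ (sym e₀) (sym e₁) r₀ , subst₂ R₁ (sym e₁) (sym e₂) r₁ , subst₂ R₂ (sym e₂) (sym e₃) r₂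

data ChildOf (i : ℕ) : ℕ → Set where
  first  : ChildOf i (i * 3)
  middle : ChildOf i (1 + i * 3)
  last   : ChildOf i (2 + i * 3)

parent : ∀ j → ∃[ i ] ChildOf i j
parent zero = 0 , first
parent (suc j) with parent j
... | i , first  = i , middle
... | i , middle = i , last
... | i , last   = suc i , first

parent-bound : ∀ {i j m} → ChildOf i j → j < 3 * m → i < m
parent-bound {i} {j} {m} c j< = *-cancelʳ-< 3 i m (begin-strict
  i * 3  ≤⟨ offset c ⟩
  j      <⟨ j< ⟩
  3 * m  ≡⟨ *-comm 3 m ⟩
  m * 3  ∎)
  where
  open ≤-Reasoning
  offset : ∀ {j} → ChildOf i j → i * 3 Data.Nat.≤ j
  offset first  = m≤n+m (i * 3) 0
  offset middle = m≤n+m (i * 3) 1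
  offset last   = m≤n+m (i * 3) 2

middle-bound : ∀ {i m} → i < m → 1 + i * 3 < 3 * m
middle-bound {i} {m} i<m = begin-strict
  1 + i * 3  <⟨ +-monoˡ-< (i * 3) (s≤s (s≤s z≤n)) ⟩
  3 + i * 3  ≤⟨ *-monoˡ-≤ 3 i<m ⟩
  m * 3      ≡⟨ *-comm m 3 ⟩
  3 * m      ∎
  where open ≤-Reasoning

adjacent : ∀ n i → i < 3 ^ n → AtPair Adjacent n i
adjacent zero    zero    _       = opposite 0 SB₀-linked
adjacent zero    (suc _) (s≤s ())
adjacent (suc n) j       j<      with parent j
... | i , c = pick c (children n i i< (refine-adjacent (adjacent n i i<)))
  where
  i< = parent-bound c j<
  pick : ∀ {j} → ChildOf i j → Children Adjacent Adjacent Adjacent n i → AtPair Adjacent (suc n) j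
  pick first  (a , _ , _) = a
  pick middle (_ , a , _) = a
  pick last   (_ , _ , a) = a

Det : ℤ → Frac → Frac → Set
Det E x y = det x y ≡ E

opposite-children : ∀ {E} n i → i < 3 ^ n → AtPair (Linked -1ℤ E) n i → Children (Det E) (Det (+ 3 *ℤ E)) (Det E) n i
opposite-children n i i< l = children n i i< (Refined-map Linked-det Linked-det Linked-det (refine-opposite l))

aligned-children : ∀ {F} n i → i < 3 ^ n → AtPair (Linked 1ℤ (+ 3 *ℤ F)) n i → Children (Det F) (Det F) (Det F) n i
aligned-children n i i< l = children n i i< (Refined-map Linked-det Linked-det Linked-det (refine-aligned l))

3^k<3^[1+k] : ∀ k → (+ 3) ^ℤ k ℤ.< (+ 3) ^ℤ suc k
3^k<3^[1+k] zero    = +<+ (s≤s (s≤s z≤n))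
3^k<3^[1+k] (suc k) = *-monoˡ-<-pos (+ 3) (3^k<3^[1+k] k)

no-strict-max-under-aligned : ∀ {F} n i {j} → i < 3 ^ n → AtPair (Linked 1ℤ (+ 3 *ℤ F)) n i → ChildOf i j →
  ¬ StrictLocalMax (suc n) j
no-strict-max-under-aligned n i i< l first (_ , right) =
  let (c₀ , c₁ , _) = aligned-children n i i< l in
  <-irrefl refl (subst₂ ℤ._<_ c₁ c₀ (right (middle-bound i<)))
no-strict-max-under-aligned n i i< l middle (left , _) =
  let (c₀ , c₁ , _) = aligned-children n i i< l in
  <-irrefl refl (subst₂ ℤ._<_ c₀ c₁ (left (i * 3) refl))
no-strict-max-under-aligned n i i< l last (left , _) =
  let (_ , c₁ , c₂) = aligned-children n i i< l in
  <-irrefl refl (subst₂ ℤ._<_ c₁ c₂ (left (1 + i * 3) refl))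

strict-max-under-opposite : ∀ {k} n i {j} → i < 3 ^ n → AtPair (Linked -1ℤ ((+ 3) ^ℤ k)) n i → ChildOf i j →
  StrictLocalMax (suc n) j → AtPair (Linked -1ℤ ((+ 3) ^ℤ suc k)) (suc n) j
strict-max-under-opposite {k} n i i< l first (_ , right) =
  let (c₀ , c₁ , _) = opposite-children n i i< l in
  ⊥-elim (<-asym (3^k<3^[1+k] k) (subst₂ ℤ._<_ c₁ c₀ (right (middle-bound i<))))
strict-max-under-opposite n i i< l middle _ =
  let (_ , l₁ , _) = children n i i< (refine-opposite l) in l₁
strict-max-under-opposite {k} n i i< l last (left , _) =
  let (_ , c₁ , c₂) = opposite-children n i i< l in
  ⊥-elim (<-asym (3^k<3^[1+k] k) (subst₂ ℤ._<_ c₁ c₂ (left (1 + i * 3) refl)))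

opposite-at-strict-max : ∀ n j → j < 3 ^ n → StrictLocalMax n j → ∃[ k ] AtPair (Linked -1ℤ ((+ 3) ^ℤ k)) n j
opposite-at-strict-max zero    zero    _        _ = 0 , SB₀-linked
opposite-at-strict-max zero    (suc _) (s≤s ()) _
opposite-at-strict-max (suc n) j j< max with parent j
... | i , c = from-parent (adjacent n i i<)
  where
  i< = parent-bound c j<
  from-parent : AtPair Adjacent n i → ∃[ k ] AtPair (Linked -1ℤ ((+ 3) ^ℤ k)) (suc n) _
  from-parent (opposite k l) = suc k , strict-max-under-opposite {k} n i i< l c max
  from-parent (aligned k l)  = ⊥-elim (no-strict-max-under-aligned n i i< l c max)

reindex : ∀ r i → r + i * 3 ≡ 3 * i + r
reindex r i = trans (+-comm r (i * 3)) (cong (_+ r) (*-comm i 3))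

lemma13 : (n i : ℕ) → i < 3 ^ n → StrictLocalMax n i →
    (C (suc n) (3 * i) ≡ C n i) × (C (suc n) (3 * i + 1) ≡ (+ 3) *ℤ C n i) × (C (suc n) (3 * i + 2) ≡ C n i)
lemma13 n i i< max =
  let (k , l) = opposite-at-strict-max n i i< max
      (c₀ , c₁ , c₂) = opposite-children n i i< l
      Cᵢ = sym (Linked-det l)
  in subst (λ j → C (suc n) j ≡ C n i) (*-comm i 3) (trans c₀ Cᵢ) ,
     subst (λ j → C (suc n) j ≡ (+ 3) *ℤ C n i) (reindex 1 i) (trans c₁ (cong ((+ 3) *ℤ_) Cᵢ)) ,
     subst (λ j → C (suc n) j ≡ C n i) (reindex 2 i) (trans c₂ Cᵢ)
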